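{- If a series–parallel graph $G$ contains the substructure $Q_2$, then $G$ is not minimally $\frac12$-tough.
   Context: All graphs are finite and undirected; parallel edges allowed. For a graph $H$, $c(H)$ denotes its number of components. A set $S\subseteq V(G)$ is a cutset if $c(G-S)>1$. $G$ is $t$-tough if $|S|\ge t\cdot c(G-S)$ for every cutset $S$; $\tau(G)$ is the largest such $t$, with $\tau(K_n)=\infty$. $G$ is minimally $t$-tough if $\tau(G)=t$ and $\tau(G-e)<t$ for every edge $e$. A series–parallel graph $G(s,t)$ with terminals $s,t$ is either a single edge $st$, or is obtained from series–parallel graphs $G_1(s_1,t_1),\dots,G_k(s_k,t_k)$, $k\ge 2$, by a series join (identify $t_i$ with $s_{i+1}$, set $s=s_1$, $t=t_k$) or a parallel join (identify all $s_i$ into $s$ and all $t_i$ into $t$). The construction gives a rooted ordered tree $T_G$ (sp-tree): leaves are edges, internal nodes are series or parallel joins, with series and parallel nodes alternating along root-to-leaf paths. A substructure of $T_G$ rooted at a node $x$ consists of $x$ together with some of its children (consecutive ones if $x$ is a series node) and the complete subtrees below those children; only the root of a substructure may have further children not in it. $P_2$ is a series node with exactly two edge children (a path $s_1v_1t_1$). $Q_2$ is the substructure consisting of a parallel node with two children: a $P_2$ and a single edge (so in $G$ it is a triangle $s_1v_1t_1$ whose edge $s_1t_1$ is a child of the parallel node). $G$ contains $Q_2$ if $T_G$ has a substructure of this form. -}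

module Defs where

open import Data.Nat using (ℕ; zero; suc)
open import Data.Unit using (⊤)
open import Data.Fin using (Fin)
open import Data.Fin.Subset using (Subset; _∉_; ∣_∣)
open import Data.List using (List; []; _∷_; _++_; length; removeAt; map; filter)
open import Data.List.Membership.Propositional using (_∈_)
open import Data.List.Relation.Unary.All using (All)
open import Data.List.Relation.Unary.Any using (Any)
open import Data.Product using (Σ; ∃; _×_; _,_; proj₁; proj₂)
open import Data.Sum using (_⊎_)
open import Data.Integer using (+_)
open import Data.Rational using (ℚ; _/_; _*_; _≤_; _<_)
open import Relation.Binary.PropositionalEquality using (_≡_; _≢_)
open import Relation.Nullary using (¬_)
open import Relation.Nullary.Decidable using (_×-dec_; _⊎-dec_)
open import Function.Definitions using (Injective)
import Data.Nat as ℕ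

-- Finite undirected multigraphs on vertex set Fin n.
-- Each edge is an (unordered) pair stored as an ordered pair; parallel
-- edges are repeated entries of the list.

record Graph : Set where
  field
    n     : ℕ
    edges : List (Fin n × Fin n)
open Graph public

deleteEdge : (G : Graph) → Fin (length (edges G)) → Graph
deleteEdge G e = record { n = n G ; edges = removeAt (edges G) e }

-- Connectivity in G - S (the graph obtained by deleting the vertex set S):
-- walks using only edges whose endpoints both lie outside S.
data Conn (G : Graph) (S : Subset (n G)) : Fin (n G) → Fin (n G) → Set where
  here : ∀ {v} → Conn G S v v
  fwd  : ∀ {a b w} → (a , b) ∈ edges G → a ∉ S → b ∉ S → Conn G S b w → Conn G S a w
  bwd  : ∀ {a b w} → (b , a) ∈ edges G → a ∉ S → b ∉ S → Conn G S b w → Conn G S a w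

-- NumComp G S k : c(G - S) = k, i.e. the components of G - S have a
-- system of representatives of size exactly k (one vertex per component).
NumComp : (G : Graph) → Subset (n G) → ℕ → Set
NumComp G S k =
  Σ (Fin k → Fin (n G)) λ r →
    (∀ i → r i ∉ S) ×
    (∀ i j → Conn G S (r i) (r j) → i ≡ j) ×
    (∀ v → v ∉ S → ∃ λ i → Conn G S v (r i))

toℚ : ℕ → ℚ
toℚ k = + k / 1

Tough : Graph → ℚ → Set
Tough G t = ∀ (S : Subset (n G)) (k : ℕ) → NumComp G S k → 1 ℕ.< k →
            t * toℚ k ≤ toℚ ∣ S ∣

data ℚ∞ : Set where
  fin : ℚ → ℚ∞
  ∞   : ℚ∞

-- τ(G) = x : x is the largest t such that G is t-tough (∞ if G is t-tough
-- for every t, e.g. complete graphs).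
IsToughness : Graph → ℚ∞ → Set
IsToughness G (fin t) = Tough G t × (∀ t' → t < t' → ¬ Tough G t')
IsToughness G ∞       = ∀ t → Tough G t

MinimallyTough : Graph → ℚ → Set
MinimallyTough G t =
  IsToughness G (fin t) ×
  (∀ e → ∃ λ t' → t' < t × IsToughness (deleteEdge G e) (fin t'))

data Kind : Set where
  series parallel : Kind

data SPT : Set where
  leaf : SPT                        -- a single edge
  node : Kind → List SPT → SPT     -- series / parallel join of the children (in order)

NotKind : Kind → SPT → Set
NotKind k leaf        = ⊤
NotKind k (node k' _) = k' ≢ k

data WF : SPT → Set where
  wf-leaf : WF leaf
  wf-node : ∀ {k cs} → 2 ℕ.≤ length cs → All (NotKind k) cs → All WF cs → WF (node k cs)

-- The graph G(s,t) of an sp-tree, with vertices labelled by naturals.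
-- gen T s t f = (edge list, next fresh label); new internal vertices
-- of series joins get the fresh labels f, f+1, ...
mutual
  gen : SPT → ℕ → ℕ → ℕ → List (ℕ × ℕ) × ℕ
  gen leaf s t f = ((s , t) ∷ []) , f
  gen (node series cs) s t f = genS cs s t f
  gen (node parallel cs) s t f = genP cs s t f

  genS : List SPT → ℕ → ℕ → ℕ → List (ℕ × ℕ) × ℕ
  genS [] s t f = [] , f
  genS (c ∷ cs) s t f = genS₁ c cs s t f

  genS₁ : SPT → List SPT → ℕ → ℕ → ℕ → List (ℕ × ℕ) × ℕ
  genS₁ c [] s t f = gen c s t f
  genS₁ c (c' ∷ cs) s t f =
    let r₁ = gen c s f (suc f)
        r₂ = genS₁ c' cs f t (proj₂ r₁)
    in proj₁ r₁ ++ proj₁ r₂ , proj₂ r₂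

  genP : List SPT → ℕ → ℕ → ℕ → List (ℕ × ℕ) × ℕ
  genP [] s t f = [] , f
  genP (c ∷ cs) s t f =
    let r₁ = gen c s t f
        r₂ = genP cs s t (proj₂ r₁)
    in proj₁ r₁ ++ proj₁ r₂ , proj₂ r₂

-- terminals s = 0, t = 1; internal vertices 2, 3, ..., m-1
spEdges : SPT → List (ℕ × ℕ)
spEdges T = proj₁ (gen T 0 1 2)

spSize : SPT → ℕ
spSize T = proj₂ (gen T 0 1 2)

mult : List (ℕ × ℕ) → ℕ → ℕ → ℕ
mult es u v = length (filter (λ e → ((proj₁ e ℕ.≟ u) ×-dec (proj₂ e ℕ.≟ v))
                                  ⊎-dec ((proj₁ e ℕ.≟ v) ×-dec (proj₂ e ℕ.≟ u))) es)

-- G is (isomorphic to) the series–parallel graph with sp-tree T: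
-- a bijection f : V(G) → {0,…,m-1} preserving all edge multiplicities.
IsSPGraphOf : Graph → SPT → Set
IsSPGraphOf G T =
  Σ (Fin (n G) → ℕ) λ f →
    Injective _≡_ _≡_ f ×
    (∀ v → f v ℕ.< spSize T) ×
    (∀ k → k ℕ.< spSize T → ∃ λ v → f v ≡ k) ×
    (∀ u v → mult (map (λ e → f (proj₁ e) , f (proj₂ e)) (edges G)) u v ≡ mult (spEdges T) u v)

P₂ : SPT
P₂ = node series (leaf ∷ leaf ∷ [])

data HasQ₂ : SPT → Set where
  here  : ∀ {cs} → P₂ ∈ cs → leaf ∈ cs → HasQ₂ (node parallel cs)
  there : ∀ {k cs} → Any HasQ₂ cs → HasQ₂ (node k cs)

-- In G, a Q₂ is a triangle v a b in which v has no neighbours besides a and b: v is the middle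
-- vertex of the P₂, a fresh label that no other part of the sp-tree touches. Deleting the edge
-- e = ab keeps G ½-tough. Let S be a cutset of G − e. If a and b are joined in G − e − S (or one
-- of them lies in S), then G − S has the same components. Otherwise v ∈ S, as the path a v b
-- would join them; restoring e merges the components of a and b, and then removing v from S adds
-- v to that component. So G − (S − v) has one component fewer than G − e − S, and the
-- ½-toughness of G for S − v (or |S| ≥ 1 when only two components remain) bounds c(G − e − S)
-- by 2|S|. Hence τ(G − e) ≥ ½, so G is not minimally ½-tough.
module Submission where

open import Defs
open import Data.Rational using (½)
open import Relation.Nullary using (¬_)

open import Data.Empty using (⊥-elim)
open import Data.Fin as Fin using (Fin; punchIn; punchOut)
open import Data.Fin.Properties
  using (punchIn-punchOut; punchOut-punchIn; punchOut-cong; punchInᵢ≢i)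
open import Data.Fin.Subset using (Subset; _∉_; _-_; _⊆_; ∣_∣; ⁅_⁆) renaming (_∈_ to _∈ₛ_)
open import Data.Fin.Subset.Properties using (_∈?_; p─q⊆p; x∈p⇒∣p-x∣<∣p∣; x∈p∧x≢y⇒x∈p-y)
open import Data.Integer as ℤ using (+_; +≤+)
import Data.Integer.Properties as ℤ
open import Data.List using (List; []; _∷_; _++_; length; map; filter; lookup; removeAt)
open import Data.List.Membership.Propositional using (_∈_)
open import Data.List.Membership.Propositional.Properties
  using ( ∈-++⁺ˡ; ∈-++⁺ʳ; ∈-++⁻; ∈-map⁺; ∈-map⁻; ∈-filter⁺; ∈-filter⁻
        ; ∈-lookup; ∈-length)
open import Data.List.Relation.Unary.All as All using (All; []; _∷_)
open import Data.List.Relation.Unary.All.Properties using (++⁺)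
open import Data.List.Relation.Unary.Any as Any using (Any; here; there; index)
open import Data.List.Relation.Unary.Any.Properties using (lookup-index)
open import Data.Nat as ℕ using (ℕ; zero; suc; _+_; _*_; _≤_; _<_; z≤n; s≤s)
import Data.Nat.Properties as ℕ
open import Data.Nat.Coprimality using (1-coprimeTo)
import Data.Nat.Coprimality as Coprime
open import Data.Product as Prod using (∃; ∃₂; _×_; _,_; proj₁; proj₂)
open import Data.Rational as ℚ using (mkℚ)
open import Data.Rational.Properties
  using (normalize-coprime; toℚᵘ-homo-*; toℚᵘ-mono-≤; toℚᵘ-cancel-≤)
import Data.Rational.Unnormalised as ℚᵘ
import Data.Rational.Unnormalised.Properties as ℚᵘ
open import Data.Sum as Sum using (_⊎_; inj₁; inj₂)
import Data.Vec.Base as Vec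
open import Function using (_∘_; id)
open import Function.Bundles using (_⇔_; mk⇔; Equivalence)
open import Function.Definitions using (Injective)
open import Relation.Nullary using (Dec; yes; no)
open import Relation.Nullary.Decidable using (_×-dec_; _⊎-dec_)
open import Relation.Binary.PropositionalEquality
  using (_≡_; _≢_; refl; sym; trans; cong; cong₂; subst; subst₂; module ≡-Reasoning)

∈-removeAt⁻ : ∀ {A : Set} {x : A} xs i → x ∈ removeAt xs i → x ∈ xs
∈-removeAt⁻ (y ∷ ys) Fin.zero    x∈         = there x∈
∈-removeAt⁻ (y ∷ ys) (Fin.suc i) (here eq)  = here eq
∈-removeAt⁻ (y ∷ ys) (Fin.suc i) (there x∈) = there (∈-removeAt⁻ ys i x∈)

∈-removeAt⁺ : ∀ {A : Set} {x : A} xs i → x ∈ xs → x ≡ lookup xs i ⊎ x ∈ removeAt xs i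
∈-removeAt⁺ (y ∷ ys) Fin.zero    (here eq)  = inj₁ eq
∈-removeAt⁺ (y ∷ ys) Fin.zero    (there x∈) = inj₂ x∈
∈-removeAt⁺ (y ∷ ys) (Fin.suc i) (here eq)  = inj₂ (here eq)
∈-removeAt⁺ (y ∷ ys) (Fin.suc i) (there x∈) = Sum.map₂ there (∈-removeAt⁺ ys i x∈)

length-pos⇒∈ : ∀ {A : Set} (xs : List A) → 0 < length xs → ∃ λ x → x ∈ xs
length-pos⇒∈ (x ∷ _) _ = x , here refl

x∉p-x : ∀ {m} (p : Subset m) (x : Fin m) → x ∉ p - x
x∉p-x (_ Vec.∷ _) Fin.zero    ()
x∉p-x (_ Vec.∷ p) (Fin.suc x) (Vec.there x∈) = x∉p-x p x x∈

module _ {A : Set} where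

  Adjacent : List (A × A) → A → A → Set
  Adjacent es x y = (x , y) ∈ es ⊎ (y , x) ∈ es

  Adjacent-sym : ∀ {es x y} → Adjacent es x y → Adjacent es y x
  Adjacent-sym = Sum.swap

  Adjacent-++⁺ˡ : ∀ {es es' x y} → Adjacent es x y → Adjacent (es ++ es') x y
  Adjacent-++⁺ˡ = Sum.map ∈-++⁺ˡ ∈-++⁺ˡ

  Adjacent-++⁺ʳ : ∀ es {es' x y} → Adjacent es' x y → Adjacent (es ++ es') x y
  Adjacent-++⁺ʳ es = Sum.map (∈-++⁺ʳ es) (∈-++⁺ʳ es)

  Adjacent-++⁻ : ∀ es {es' x y} → Adjacent (es ++ es') x y → Adjacent es x y ⊎ Adjacent es' x y
  Adjacent-++⁻ es (inj₁ xy∈) = Sum.map inj₁ inj₁ (∈-++⁻ es xy∈)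
  Adjacent-++⁻ es (inj₂ yx∈) = Sum.map inj₂ inj₂ (∈-++⁻ es yx∈)

  AllEndpoints : (A → Set) → List (A × A) → Set
  AllEndpoints P = All (λ e → P (proj₁ e) × P (proj₂ e))

  AllEndpoints-map : ∀ {P Q : A → Set} {es} →
                     (∀ {z} → P z → Q z) → AllEndpoints P es → AllEndpoints Q es
  AllEndpoints-map f = All.map (Prod.map f f)

  Avoids : A → List (A × A) → Set
  Avoids v = AllEndpoints (_≢ v)

  Avoids⇒¬Adjacent : ∀ {v es x} → Avoids v es → ¬ Adjacent es v x
  Avoids⇒¬Adjacent avoid (inj₁ vx∈) = proj₁ (All.lookup avoid vx∈) refl
  Avoids⇒¬Adjacent avoid (inj₂ xv∈) = proj₂ (All.lookup avoid xv∈) refl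

  record Wedge (es : List (A × A)) (v a b : A) : Set where
    field
      v≢a           : v ≢ a
      v≢b           : v ≢ b
      v~a           : Adjacent es v a
      v~b           : Adjacent es v b
      neighbour⇒a⊎b : ∀ {x} → Adjacent es v x → x ≡ a ⊎ x ≡ b

  record Q₂Triangle (es : List (A × A)) (v a b : A) : Set where
    field
      wedge : Wedge es v a b
      base  : Adjacent es a b

  HasQ₂Triangle : List (A × A) → A → Set
  HasQ₂Triangle es v = ∃₂ λ a b → Q₂Triangle es v a b

  Wedge-swap : ∀ {es v a b} → Wedge es v a b → Wedge es v b a
  Wedge-swap w = record
    { v≢a = v≢b ; v≢b = v≢a ; v~a = v~b ; v~b = v~a
    ; neighbour⇒a⊎b = Sum.swap ∘ neighbour⇒a⊎b }
    where open Wedge w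

  Wedge-transfer : ∀ {es es' v a b} →
                   (∀ {x} → Adjacent es v x → Adjacent es' v x) →
                   (∀ {x} → Adjacent es' v x → Adjacent es v x) →
                   Wedge es v a b → Wedge es' v a b
  Wedge-transfer to from w = record
    { v≢a = v≢a ; v≢b = v≢b ; v~a = to v~a ; v~b = to v~b
    ; neighbour⇒a⊎b = neighbour⇒a⊎b ∘ from }
    where open Wedge w

  Q₂Triangle-transfer : ∀ {es es' v a b} → (∀ {x y} → Adjacent es x y ⇔ Adjacent es' x y) →
                        Q₂Triangle es v a b → Q₂Triangle es' v a b
  Q₂Triangle-transfer adj t = record
    { wedge = Wedge-transfer (Equivalence.to adj) (Equivalence.from adj) wedge
    ; base  = Equivalence.to adj base }
    where open Q₂Triangle t

  AppendStable : (List (A × A) → A → Set) → Set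
  AppendStable P = ∀ es {es' v} → Avoids v es' → P es v → P (es' ++ es) v × P (es ++ es') v

  Wedge-appendStable : ∀ {a b} → AppendStable (λ es v → Wedge es v a b)
  Wedge-appendStable es {es'} {v} avoid w =
      Wedge-transfer (Adjacent-++⁺ʳ es') (Sum.[ ⊥-elim ∘ ¬adj , id ] ∘ Adjacent-++⁻ es') w
    , Wedge-transfer Adjacent-++⁺ˡ (Sum.[ id , ⊥-elim ∘ ¬adj ] ∘ Adjacent-++⁻ es) w
    where
    ¬adj : ∀ {x} → ¬ Adjacent es' v x
    ¬adj = Avoids⇒¬Adjacent avoid

  HasQ₂Triangle-appendStable : AppendStable HasQ₂Triangle
  HasQ₂Triangle-appendStable es {es'} avoid (a , b , t) =
      (a , b , record { wedge = proj₁ wedges ; base = Adjacent-++⁺ʳ es' base })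
    , (a , b , record { wedge = proj₂ wedges ; base = Adjacent-++⁺ˡ base })
    where
    open Q₂Triangle t
    wedges = Wedge-appendStable es avoid wedge

-- The filter predicate of mult, named so that ∈-filter⁺ and ∈-filter⁻ can be given it.
joins? : ∀ u v (e : ℕ × ℕ) → Dec ((proj₁ e ≡ u × proj₂ e ≡ v) ⊎ (proj₁ e ≡ v × proj₂ e ≡ u))
joins? u v e =
  ((proj₁ e ℕ.≟ u) ×-dec (proj₂ e ℕ.≟ v)) ⊎-dec ((proj₁ e ℕ.≟ v) ×-dec (proj₂ e ℕ.≟ u))

Adjacent⇒mult-pos : ∀ es u v → Adjacent es u v → 0 < mult es u v
Adjacent⇒mult-pos es u v (inj₁ uv∈) = ∈-length (∈-filter⁺ (joins? u v) uv∈ (inj₁ (refl , refl)))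
Adjacent⇒mult-pos es u v (inj₂ vu∈) = ∈-length (∈-filter⁺ (joins? u v) vu∈ (inj₂ (refl , refl)))

mult-pos⇒Adjacent : ∀ es u v → 0 < mult es u v → Adjacent es u v
mult-pos⇒Adjacent es u v pos with length-pos⇒∈ (filter (joins? u v) es) pos
... | _ , e∈ with ∈-filter⁻ (joins? u v) e∈
...   | uv∈ , inj₁ (refl , refl) = inj₁ uv∈
...   | vu∈ , inj₂ (refl , refl) = inj₂ vu∈

mult-transfer : ∀ {es es'} → (∀ u v → mult es u v ≡ mult es' u v) →
                ∀ {u v} → Adjacent es u v ⇔ Adjacent es' u v
mult-transfer {es} {es'} mult≡ {u} {v} = mk⇔
  (mult-pos⇒Adjacent es' u v ∘ subst (0 <_) (mult≡ u v) ∘ Adjacent⇒mult-pos es u v)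
  (mult-pos⇒Adjacent es u v ∘ subst (0 <_) (sym (mult≡ u v)) ∘ Adjacent⇒mult-pos es' u v)

module _ {A B : Set} {f : A → B} where

  private
    f² : A × A → B × B
    f² = Prod.map f f

  ∈-map-pair⁻ : Injective _≡_ _≡_ f → ∀ {es x y} → (f x , f y) ∈ map f² es → (x , y) ∈ es
  ∈-map-pair⁻ f-inj {es} fxy∈ with ∈-map⁻ f² fxy∈
  ... | _ , e∈ , fxy≡ =
    subst (_∈ es) (sym (cong₂ _,_ (f-inj (cong proj₁ fxy≡)) (f-inj (cong proj₂ fxy≡)))) e∈

  Adjacent-map⁺ : ∀ {es x y} → Adjacent es x y → Adjacent (map f² es) (f x) (f y)
  Adjacent-map⁺ = Sum.map (∈-map⁺ f²) (∈-map⁺ f²)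

  Adjacent-map⁻ : Injective _≡_ _≡_ f → ∀ {es x y} →
                  Adjacent (map f² es) (f x) (f y) → Adjacent es x y
  Adjacent-map⁻ f-inj = Sum.map (∈-map-pair⁻ f-inj) (∈-map-pair⁻ f-inj)

  Adjacent-map-preimage : ∀ {es X Y} → Adjacent (map f² es) X Y → ∃ λ x → f x ≡ X
  Adjacent-map-preimage (inj₁ XY∈) with ∈-map⁻ f² XY∈
  ... | e , _ , XY≡ = proj₁ e , sym (cong proj₁ XY≡)
  Adjacent-map-preimage (inj₂ YX∈) with ∈-map⁻ f² YX∈
  ... | e , _ , YX≡ = proj₂ e , sym (cong proj₂ YX≡)

  Q₂Triangle-map⁻ : Injective _≡_ _≡_ f → ∀ {es v a b} →
                    Q₂Triangle (map f² es) (f v) (f a) (f b) → Q₂Triangle es v a b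
  Q₂Triangle-map⁻ f-inj t = record
    { wedge = record
      { v≢a = v≢a ∘ cong f
      ; v≢b = v≢b ∘ cong f
      ; v~a = Adjacent-map⁻ f-inj v~a
      ; v~b = Adjacent-map⁻ f-inj v~b
      ; neighbour⇒a⊎b = Sum.map f-inj f-inj ∘ neighbour⇒a⊎b ∘ Adjacent-map⁺ }
    ; base = Adjacent-map⁻ f-inj base }
    where open Q₂Triangle t; open Wedge wedge

  Q₂Triangle-pullback : Injective _≡_ _≡_ f → ∀ {es V X Y} →
                        Q₂Triangle (map f² es) V X Y → ∃ λ v → HasQ₂Triangle es v
  Q₂Triangle-pullback f-inj t
    with Adjacent-map-preimage (Wedge.v~a (Q₂Triangle.wedge t))
       | Adjacent-map-preimage (Adjacent-sym (Wedge.v~a (Q₂Triangle.wedge t)))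
       | Adjacent-map-preimage (Adjacent-sym (Wedge.v~b (Q₂Triangle.wedge t)))
  ... | v , refl | a , refl | b , refl = v , a , b , Q₂Triangle-map⁻ f-inj t

IsSPGraphOf-Q₂Triangle : ∀ {G T V X Y} → IsSPGraphOf G T → Q₂Triangle (spEdges T) V X Y →
                         ∃ λ v → HasQ₂Triangle (edges G) v
IsSPGraphOf-Q₂Triangle (f , f-inj , _ , _ , mult≡) t =
  Q₂Triangle-pullback f-inj (Q₂Triangle-transfer (mult-transfer (λ u v → sym (mult≡ u v))) t)

edgesOf : List (ℕ × ℕ) × ℕ → List (ℕ × ℕ)
edgesOf = proj₁

next : List (ℕ × ℕ) × ℕ → ℕ
next = proj₂

mutual
  next-gen-≥ : ∀ c s t f → f ≤ next (gen c s t f)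
  next-gen-≥ leaf               s t f = ℕ.≤-refl
  next-gen-≥ (node series cs)   = next-genS-≥ cs
  next-gen-≥ (node parallel cs) = next-genP-≥ cs

  next-genS-≥ : ∀ cs s t f → f ≤ next (genS cs s t f)
  next-genS-≥ []       s t f = ℕ.≤-refl
  next-genS-≥ (c ∷ cs) = next-genS₁-≥ c cs

  next-genS₁-≥ : ∀ c cs s t f → f ≤ next (genS₁ c cs s t f)
  next-genS₁-≥ c []        = next-gen-≥ c
  next-genS₁-≥ c (c' ∷ cs) s t f =
    ℕ.≤-trans (ℕ.n≤1+n f) (ℕ.≤-trans (next-gen-≥ c s f (suc f)) (next-genS₁-≥ c' cs f t _))

  next-genP-≥ : ∀ cs s t f → f ≤ next (genP cs s t f)
  next-genP-≥ []       s t f = ℕ.≤-refl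
  next-genP-≥ (c ∷ cs) s t f = ℕ.≤-trans (next-gen-≥ c s t f) (next-genP-≥ cs s t _)

TerminalOrFresh : ℕ → ℕ → ℕ → ℕ → ℕ → Set
TerminalOrFresh s t f o z = z ≡ s ⊎ z ≡ t ⊎ (f ≤ z × z < o)

TerminalOrFresh-widen : ∀ {s t f f' o o' z} → f' ≤ f → o ≤ o' →
                        TerminalOrFresh s t f o z → TerminalOrFresh s t f' o' z
TerminalOrFresh-widen f'≤f o≤o' =
  Sum.map₂ (Sum.map₂ (Prod.map (ℕ.≤-trans f'≤f) (λ z<o → ℕ.<-≤-trans z<o o≤o')))

TerminalOrFresh-≢ : ∀ {s t f o v z} → s < v → t < v → v < f ⊎ o ≤ v →
                    TerminalOrFresh s t f o z → z ≢ v
TerminalOrFresh-≢ s<v _   _          (inj₁ refl)              refl = ℕ.<-irrefl refl s<v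
TerminalOrFresh-≢ _   t<v _          (inj₂ (inj₁ refl))       refl = ℕ.<-irrefl refl t<v
TerminalOrFresh-≢ _   _   (inj₁ v<f) (inj₂ (inj₂ (f≤v , _))) refl = ℕ.<⇒≱ v<f f≤v
TerminalOrFresh-≢ _   _   (inj₂ o≤v) (inj₂ (inj₂ (_ , v<o))) refl = ℕ.<⇒≱ v<o o≤v

GenLabels : ℕ → ℕ → ℕ → List (ℕ × ℕ) × ℕ → Set
GenLabels s t f r = AllEndpoints (TerminalOrFresh s t f (next r)) (edgesOf r)

mutual
  gen-labels : ∀ c s t f → GenLabels s t f (gen c s t f)
  gen-labels leaf               s t f = (inj₁ refl , inj₂ (inj₁ refl)) ∷ []
  gen-labels (node series cs)   = genS-labels cs
  gen-labels (node parallel cs) = genP-labels cs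

  genS-labels : ∀ cs s t f → GenLabels s t f (genS cs s t f)
  genS-labels []       s t f = []
  genS-labels (c ∷ cs) = genS₁-labels c cs

  genS₁-labels : ∀ c cs s t f → GenLabels s t f (genS₁ c cs s t f)
  genS₁-labels c []        = gen-labels c
  genS₁-labels c (c' ∷ cs) s t f =
    ++⁺ (AllEndpoints-map first (gen-labels c s f (suc f)))
        (AllEndpoints-map rest (genS₁-labels c' cs f t o₁))
    where
    o₁ = next (gen c s f (suc f))
    o₂ = next (genS₁ c' cs f t o₁)
    f<o₁ : f < o₁
    f<o₁ = next-gen-≥ c s f (suc f)
    o₁≤o₂ : o₁ ≤ o₂
    o₁≤o₂ = next-genS₁-≥ c' cs f t o₁
    f-fresh : TerminalOrFresh s t f o₂ f
    f-fresh = inj₂ (inj₂ (ℕ.≤-refl , ℕ.<-≤-trans f<o₁ o₁≤o₂))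
    first : ∀ {z} → TerminalOrFresh s f (suc f) o₁ z → TerminalOrFresh s t f o₂ z
    first (inj₁ z≡s)         = inj₁ z≡s
    first (inj₂ (inj₁ refl)) = f-fresh
    first (inj₂ (inj₂ z∈))   = TerminalOrFresh-widen (ℕ.n≤1+n f) o₁≤o₂ (inj₂ (inj₂ z∈))
    rest : ∀ {z} → TerminalOrFresh f t o₁ o₂ z → TerminalOrFresh s t f o₂ z
    rest (inj₁ refl)       = f-fresh
    rest (inj₂ (inj₁ z≡t)) = inj₂ (inj₁ z≡t)
    rest (inj₂ (inj₂ z∈))  = TerminalOrFresh-widen (ℕ.<⇒≤ f<o₁) ℕ.≤-refl (inj₂ (inj₂ z∈))

  genP-labels : ∀ cs s t f → GenLabels s t f (genP cs s t f)
  genP-labels []       s t f = []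
  genP-labels (c ∷ cs) s t f =
    ++⁺ (AllEndpoints-map (TerminalOrFresh-widen ℕ.≤-refl (next-genP-≥ cs s t o₁))
                          (gen-labels c s t f))
        (AllEndpoints-map (TerminalOrFresh-widen (next-gen-≥ c s t f) ℕ.≤-refl)
                          (genP-labels cs s t o₁))
    where o₁ = next (gen c s t f)

-- Keeping the witness among the fresh labels of its own subtree is what makes it survive the
-- edges of all other subtrees, which avoid those labels.
HasFresh : (List (ℕ × ℕ) → ℕ → Set) → ℕ → ℕ → (ℕ → List (ℕ × ℕ) × ℕ) → Set
HasFresh P s t g = ∀ f → s < f → t < f → ∃ λ v → f ≤ v × v < next (g f) × P (edgesOf (g f)) v

genP-hasFresh : ∀ {P s t} → AppendStable P → ∀ cs →
                Any (λ c → HasFresh P s t (gen c s t)) cs → HasFresh P s t (genP cs s t)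
genP-hasFresh {s = s} {t} stable (c ∷ cs) (here found) f s<f t<f =
  let v , f≤v , v<o₁ , pv = found f s<f t<f
      avoid = AllEndpoints-map
                (TerminalOrFresh-≢ (ℕ.<-≤-trans s<f f≤v) (ℕ.<-≤-trans t<f f≤v) (inj₁ v<o₁))
                (genP-labels cs s t o₁)
  in  v , f≤v , ℕ.<-≤-trans v<o₁ (next-genP-≥ cs s t o₁)
    , proj₂ (stable (edgesOf (gen c s t f)) avoid pv)
  where o₁ = next (gen c s t f)
genP-hasFresh {s = s} {t} stable (c ∷ cs) (there found) f s<f t<f =
  let v , o₁≤v , v<o₂ , pv = genP-hasFresh stable cs found o₁ (ℕ.<-≤-trans s<f f≤o₁)
                                                              (ℕ.<-≤-trans t<f f≤o₁)
      f≤v = ℕ.≤-trans f≤o₁ o₁≤v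
      avoid = AllEndpoints-map
                (TerminalOrFresh-≢ (ℕ.<-≤-trans s<f f≤v) (ℕ.<-≤-trans t<f f≤v) (inj₂ o₁≤v))
                (gen-labels c s t f)
  in  v , f≤v , v<o₂ , proj₁ (stable (edgesOf (genP cs s t o₁)) avoid pv)
  where
  o₁ = next (gen c s t f)
  f≤o₁ : f ≤ o₁
  f≤o₁ = next-gen-≥ c s t f

genS₁-hasFresh : ∀ {P} → AppendStable P → ∀ c cs →
                 Any (λ c → ∀ s t → HasFresh P s t (gen c s t)) (c ∷ cs) →
                 ∀ s t → HasFresh P s t (genS₁ c cs s t)
genS₁-hasFresh stable c []        (here found) = found
genS₁-hasFresh stable c (c' ∷ cs) (here found) s t f s<f t<f =
  let v , f<v , v<o₁ , pv = found s f (suc f) (ℕ.m<n⇒m<1+n s<f) (ℕ.n<1+n f)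
      avoid = AllEndpoints-map (TerminalOrFresh-≢ f<v (ℕ.<-trans t<f f<v) (inj₁ v<o₁))
                               (genS₁-labels c' cs f t o₁)
  in  v , ℕ.<⇒≤ f<v , ℕ.<-≤-trans v<o₁ (next-genS₁-≥ c' cs f t o₁)
    , proj₂ (stable (edgesOf (gen c s f (suc f))) avoid pv)
  where o₁ = next (gen c s f (suc f))
genS₁-hasFresh stable c (c' ∷ cs) (there found) s t f s<f t<f =
  let v , o₁≤v , v<o₂ , pv = genS₁-hasFresh stable c' cs found f t o₁ f<o₁ (ℕ.<-trans t<f f<o₁)
      f<v = ℕ.<-≤-trans f<o₁ o₁≤v
      avoid = AllEndpoints-map (TerminalOrFresh-≢ (ℕ.<-trans s<f f<v) f<v (inj₂ o₁≤v))
                               (gen-labels c s f (suc f))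
  in  v , ℕ.<⇒≤ f<v , v<o₂ , proj₁ (stable (edgesOf (genS₁ c' cs f t o₁)) avoid pv)
  where
  o₁ = next (gen c s f (suc f))
  f<o₁ : f < o₁
  f<o₁ = next-gen-≥ c s f (suc f)

P₂-hasFresh : ∀ s t → HasFresh (λ es v → Wedge es v s t) s t (gen P₂ s t)
P₂-hasFresh s t f s<f t<f = f , ℕ.≤-refl , ℕ.n<1+n f , record
  { v≢a = ℕ.>⇒≢ s<f
  ; v≢b = ℕ.>⇒≢ t<f
  ; v~a = inj₂ (here refl)
  ; v~b = inj₁ (there (here refl))
  ; neighbour⇒a⊎b = neighbour⇒s⊎t }
  where
  neighbour⇒s⊎t : ∀ {x} → Adjacent ((s , f) ∷ (f , t) ∷ []) f x → x ≡ s ⊎ x ≡ t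
  neighbour⇒s⊎t (inj₁ (here fx≡sf))         = ⊥-elim (ℕ.>⇒≢ s<f (cong proj₁ fx≡sf))
  neighbour⇒s⊎t (inj₁ (there (here fx≡ft))) = inj₂ (cong proj₂ fx≡ft)
  neighbour⇒s⊎t (inj₂ (here xf≡sf))         = inj₁ (cong proj₁ xf≡sf)
  neighbour⇒s⊎t (inj₂ (there (here xf≡ft))) = ⊥-elim (ℕ.>⇒≢ t<f (cong proj₂ xf≡ft))

genP-leaf : ∀ cs s t f → leaf ∈ cs → (s , t) ∈ edgesOf (genP cs s t f)
genP-leaf (c ∷ cs) s t f (here refl)   = here refl
genP-leaf (c ∷ cs) s t f (there leaf∈) = ∈-++⁺ʳ _ (genP-leaf cs s t _ leaf∈)

mutual
  HasQ₂⇒hasFresh : ∀ {T} → HasQ₂ T → ∀ s t → HasFresh HasQ₂Triangle s t (gen T s t)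
  HasQ₂⇒hasFresh {node parallel cs} (here P₂∈ leaf∈) s t f s<f t<f =
    let v , f≤v , v<o , wedge = genP-hasFresh Wedge-appendStable cs
                                  (Any.map (λ { refl → P₂-hasFresh s t }) P₂∈) f s<f t<f
    in  v , f≤v , v<o , s , t , record { wedge = wedge ; base = inj₁ (genP-leaf cs s t f leaf∈) }
  HasQ₂⇒hasFresh {node series (c ∷ cs)} (there found) =
    genS₁-hasFresh HasQ₂Triangle-appendStable c cs (HasQ₂⇒hasFresh-any found)
  HasQ₂⇒hasFresh {node parallel cs}     (there found) s t =
    genP-hasFresh HasQ₂Triangle-appendStable cs
      (Any.map (λ found → found s t) (HasQ₂⇒hasFresh-any found))

  HasQ₂⇒hasFresh-any : ∀ {cs} → Any HasQ₂ cs →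
                       Any (λ c → ∀ s t → HasFresh HasQ₂Triangle s t (gen c s t)) cs
  HasQ₂⇒hasFresh-any (here found)  = here (HasQ₂⇒hasFresh found)
  HasQ₂⇒hasFresh-any (there found) = there (HasQ₂⇒hasFresh-any found)

spEdges-Q₂Triangle : ∀ {T} → HasQ₂ T → ∃ λ v → HasQ₂Triangle (spEdges T) v
spEdges-Q₂Triangle q with HasQ₂⇒hasFresh q 0 1 2 (s≤s z≤n) (s≤s (s≤s z≤n))
... | v , _ , _ , triangle = v , triangle

merge : ∀ {k} {i j : Fin (suc k)} → i ≢ j → Fin (suc k) → Fin k
merge {j = j} i≢j l with j Fin.≟ l
... | yes _   = punchOut (i≢j ∘ sym)
... | no  j≢l = punchOut j≢l

module _ {k} {i j : Fin (suc k)} (i≢j : i ≢ j) where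

  merge-identifies : merge i≢j i ≡ merge i≢j j
  merge-identifies with j Fin.≟ i | j Fin.≟ j
  ... | yes j≡i | _       = ⊥-elim (i≢j (sym j≡i))
  ... | no  _   | no  j≢j = ⊥-elim (j≢j refl)
  ... | no  _   | yes _   = punchOut-cong j refl

  merge-punchIn : ∀ l → merge i≢j (punchIn j l) ≡ l
  merge-punchIn l with j Fin.≟ punchIn j l
  ... | yes j≡ = ⊥-elim (punchInᵢ≢i j l (sym j≡))
  ... | no  _  = trans (punchOut-cong j refl) (punchOut-punchIn j)

  punchIn-merge-≢ : ∀ {l} → l ≢ j → punchIn j (merge i≢j l) ≡ l
  punchIn-merge-≢ {l} l≢j with j Fin.≟ l
  ... | yes j≡l = ⊥-elim (l≢j (sym j≡l))
  ... | no  j≢l = punchIn-punchOut j≢l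

  punchIn-merge-≡ : punchIn j (merge i≢j j) ≡ i
  punchIn-merge-≡ with j Fin.≟ j
  ... | yes _   = punchIn-punchOut (i≢j ∘ sym)
  ... | no  j≢j = ⊥-elim (j≢j refl)

module _ {G : Graph} {S : Subset (n G)} where

  Conn-trans : ∀ {x y z} → Conn G S x y → Conn G S y z → Conn G S x z
  Conn-trans here                  c' = c'
  Conn-trans (fwd xy∈ x∉S y∉S c) c' = fwd xy∈ x∉S y∉S (Conn-trans c c')
  Conn-trans (bwd yx∈ x∉S y∉S c) c' = bwd yx∈ x∉S y∉S (Conn-trans c c')

  Conn-edge : ∀ {x y} → Adjacent (edges G) x y → x ∉ S → y ∉ S → Conn G S x y
  Conn-edge (inj₁ xy∈) x∉S y∉S = fwd xy∈ x∉S y∉S here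
  Conn-edge (inj₂ yx∈) x∉S y∉S = bwd yx∈ x∉S y∉S here

  Conn-sym : ∀ {x y} → Conn G S x y → Conn G S y x
  Conn-sym here                  = here
  Conn-sym (fwd xy∈ x∉S y∉S c) = Conn-trans (Conn-sym c) (Conn-edge (inj₂ xy∈) y∉S x∉S)
  Conn-sym (bwd yx∈ x∉S y∉S c) = Conn-trans (Conn-sym c) (Conn-edge (inj₁ yx∈) y∉S x∉S)

  Conn-∉ : ∀ {x y} → Conn G S x y → y ∉ S → x ∉ S
  Conn-∉ here            y∉S = y∉S
  Conn-∉ (fwd _ x∉S _ _) _   = x∉S
  Conn-∉ (bwd _ x∉S _ _) _   = x∉S

  Conn-⊆ : ∀ {S' x y} → S' ⊆ S → Conn G S x y → Conn G S' x y
  Conn-⊆ S'⊆S here = here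
  Conn-⊆ S'⊆S (fwd xy∈ x∉S y∉S c) =
    fwd xy∈ (x∉S ∘ S'⊆S) (y∉S ∘ S'⊆S) (Conn-⊆ S'⊆S c)
  Conn-⊆ S'⊆S (bwd yx∈ x∉S y∉S c) =
    bwd yx∈ (x∉S ∘ S'⊆S) (y∉S ∘ S'⊆S) (Conn-⊆ S'⊆S c)

  Conn-deleteEdge⁻ : ∀ e {x y} → Conn (deleteEdge G e) S x y → Conn G S x y
  Conn-deleteEdge⁻ e here = here
  Conn-deleteEdge⁻ e (fwd xy∈ x∉S y∉S c) =
    fwd (∈-removeAt⁻ (edges G) e xy∈) x∉S y∉S (Conn-deleteEdge⁻ e c)
  Conn-deleteEdge⁻ e (bwd yx∈ x∉S y∉S c) =
    bwd (∈-removeAt⁻ (edges G) e yx∈) x∉S y∉S (Conn-deleteEdge⁻ e c)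

  Conn? : ∀ {k x y} → NumComp G S k → x ∉ S → y ∉ S → Dec (Conn G S x y)
  Conn? (_ , _ , distinct , cover) x∉S y∉S with cover _ x∉S | cover _ y∉S
  ... | i , cx | j , cy with i Fin.≟ j
  ...   | yes refl = yes (Conn-trans cx (Conn-sym cy))
  ...   | no  i≢j  = no λ c → i≢j (distinct i j (Conn-trans (Conn-sym cx) (Conn-trans c cy)))

record ComponentLabelling (G : Graph) (S : Subset (n G)) (k : ℕ) : Set₁ where
  field
    rep          : Fin k → Fin (n G)
    Label        : Fin (n G) → Fin k → Set
    rep∉S        : ∀ i → rep i ∉ S
    rep-label    : ∀ i → Label (rep i) i
    label-unique : ∀ {x i j} → Label x i → Label x j → i ≡ j
    label-edge   : ∀ {x y i j} → (x , y) ∈ edges G → x ∉ S → y ∉ S →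
                   Label x i → Label y j → i ≡ j
    labelled     : ∀ {x} → x ∉ S → ∃ λ i → Label x i × Conn G S x (rep i)

numComp-fromLabelling : ∀ {G S k} → ComponentLabelling G S k → NumComp G S k
numComp-fromLabelling {G} {S} L =
    rep , rep∉S
  , (λ i j c → Conn⇒same-label c (rep-label i) (rep-label j))
  , (λ _ x∉S → Prod.map₂ proj₂ (labelled x∉S))
  where
  open ComponentLabelling L
  Conn⇒same-label : ∀ {x y i j} → Conn G S x y → Label x i → Label y j → i ≡ j
  Conn⇒same-label here ℓx ℓy = label-unique ℓx ℓy
  Conn⇒same-label (fwd xy∈ x∉S y∉S c) ℓx ℓz =
    let _ , ℓy , _ = labelled y∉S
    in  trans (label-edge xy∈ x∉S y∉S ℓx ℓy) (Conn⇒same-label c ℓy ℓz)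
  Conn⇒same-label (bwd yx∈ x∉S y∉S c) ℓx ℓz =
    let _ , ℓy , _ = labelled y∉S
    in  trans (sym (label-edge yx∈ y∉S x∉S ℓy ℓx)) (Conn⇒same-label c ℓy ℓz)

numComp-restoreVertex : ∀ {G S k v w} → v ∈ₛ S → Adjacent (edges G) v w → w ∉ S →
                        (∀ {x} → Adjacent (edges G) v x → Conn G S x w) →
                        NumComp G S k → NumComp G (S - v) k
numComp-restoreVertex {G} {S} {v = v} {w} v∈S v~w w∉S neighbour~w (r , r∉S , distinct , cover) =
  numComp-fromLabelling record
    { rep          = r
    ; Label        = Label
    ; rep∉S        = λ i → r∉S i ∘ S-v⊆S
    ; rep-label    = λ _ → inj₁ here
    ; label-unique = label-unique
    ; label-edge   = label-edge
    ; labelled     = labelled }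
  where
  S-v⊆S : S - v ⊆ S
  S-v⊆S = p─q⊆p S ⁅ v ⁆

  Label : Fin (n G) → Fin _ → Set
  Label x i = Conn G S x (r i) ⊎ (x ≡ v × Conn G S w (r i))

  same-component : ∀ {x y i j} → Conn G S x (r i) → Conn G S y (r j) → Conn G S x y → i ≡ j
  same-component cx cy xy = distinct _ _ (Conn-trans (Conn-sym cx) (Conn-trans xy cy))

  v≁r : ∀ {i} → ¬ Conn G S v (r i)
  v≁r {i} c = Conn-∉ c (r∉S i) v∈S

  label-unique : ∀ {x i j} → Label x i → Label x j → i ≡ j
  label-unique (inj₁ cx)         (inj₁ cx')        = same-component cx cx' here
  label-unique (inj₁ cv)         (inj₂ (refl , _)) = ⊥-elim (v≁r cv)
  label-unique (inj₂ (refl , _)) (inj₁ cv)         = ⊥-elim (v≁r cv)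
  label-unique (inj₂ (_ , cw))   (inj₂ (_ , cw'))  = same-component cw cw' here

  label-edge : ∀ {x y i j} → (x , y) ∈ edges G → x ∉ S - v → y ∉ S - v →
               Label x i → Label y j → i ≡ j
  label-edge xy∈ _ _ (inj₁ cx) (inj₁ cy) =
    same-component cx cy (Conn-edge (inj₁ xy∈) (Conn-∉ cx (r∉S _)) (Conn-∉ cy (r∉S _)))
  label-edge xy∈ _ _ (inj₁ cx) (inj₂ (refl , cw)) =
    same-component cx cw (neighbour~w (inj₂ xy∈))
  label-edge xy∈ _ _ (inj₂ (refl , cw)) (inj₁ cy) =
    same-component cw cy (Conn-sym (neighbour~w (inj₁ xy∈)))
  label-edge xy∈ _ _ (inj₂ (_ , cw)) (inj₂ (_ , cw')) =
    same-component cw cw' here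

  labelled : ∀ {x} → x ∉ S - v → ∃ λ i → Label x i × Conn G (S - v) x (r i)
  labelled {x} x∉S-v with x Fin.≟ v
  ... | yes refl =
    let i , cw = cover w w∉S
    in  i , inj₂ (refl , cw) ,
        Conn-trans (Conn-edge v~w (x∉p-x S v) (w∉S ∘ S-v⊆S)) (Conn-⊆ S-v⊆S cw)
  ... | no  x≢v =
    let i , cx = cover x (λ x∈S → x∉S-v (x∈p∧x≢y⇒x∈p-y x∈S x≢v))
    in  i , inj₁ cx , Conn-⊆ S-v⊆S cx

HalfTough : Graph → Set
HalfTough G = ∀ S k → NumComp G S k → 1 < k → k ≤ 2 * ∣ S ∣

suc-≤-2*-step : ∀ {m s' s} → s' < s → (1 < suc m → suc m ≤ 2 * s') → suc (suc m) ≤ 2 * s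
suc-≤-2*-step {zero}           s'<s _     = ℕ.*-monoʳ-≤ 2 (ℕ.≤-trans (s≤s z≤n) s'<s)
suc-≤-2*-step {suc m} {s'} {s} s'<s bound = begin
  3 + m          ≤⟨ s≤s (bound (s≤s (s≤s z≤n))) ⟩
  1 + 2 * s'     ≤⟨ ℕ.n≤1+n _ ⟩
  2 * 1 + 2 * s' ≡⟨ ℕ.*-distribˡ-+ 2 1 s' ⟨
  2 * suc s'     ≤⟨ ℕ.*-monoʳ-≤ 2 s'<s ⟩
  2 * s          ∎
  where open ℕ.≤-Reasoning

module _ {G : Graph} {e : Fin (length (edges G))} {a b : Fin (n G)}
         (e≡ab : lookup (edges G) e ≡ (a , b)) where

  private
    G-e : Graph
    G-e = deleteEdge G e

    ab∈ : (a , b) ∈ edges G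
    ab∈ = subst (_∈ edges G) e≡ab (∈-lookup e)

  ∈-edges⇒≡ab⊎∈ : ∀ {x y} → (x , y) ∈ edges G → (x ≡ a × y ≡ b) ⊎ (x , y) ∈ edges G-e
  ∈-edges⇒≡ab⊎∈ xy∈ =
    Sum.map₁ (λ xy≡ → cong proj₁ (trans xy≡ e≡ab) , cong proj₂ (trans xy≡ e≡ab))
             (∈-removeAt⁺ (edges G) e xy∈)

  Adjacent-deleteEdge⁺ : ∀ {v x} → v ≢ a → v ≢ b →
                         Adjacent (edges G) v x → Adjacent (edges G-e) v x
  Adjacent-deleteEdge⁺ v≢a _ (inj₁ vx∈) =
    inj₁ (Sum.[ ⊥-elim ∘ v≢a ∘ proj₁ , id ] (∈-edges⇒≡ab⊎∈ vx∈))
  Adjacent-deleteEdge⁺ _ v≢b (inj₂ xv∈) =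
    inj₂ (Sum.[ ⊥-elim ∘ v≢b ∘ proj₂ , id ] (∈-edges⇒≡ab⊎∈ xv∈))

  numComp-restoreEdge-connected : ∀ {S k} → (a ∉ S → b ∉ S → Conn G-e S a b) →
                                  NumComp G-e S k → NumComp G S k
  numComp-restoreEdge-connected {S} a~b (r , r∉S , distinct , cover) = numComp-fromLabelling record
    { rep          = r
    ; Label        = λ x i → Conn G-e S x (r i)
    ; rep∉S        = r∉S
    ; rep-label    = λ _ → here
    ; label-unique = λ cx cx' → distinct _ _ (Conn-trans (Conn-sym cx) cx')
    ; label-edge   = label-edge
    ; labelled     = λ x∉S → Prod.map₂ (λ c → c , Conn-deleteEdge⁻ e c) (cover _ x∉S) }
    where
    label-edge : ∀ {x y i j} → (x , y) ∈ edges G → x ∉ S → y ∉ S →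
                 Conn G-e S x (r i) → Conn G-e S y (r j) → i ≡ j
    label-edge xy∈ x∉S y∉S cx cy = distinct _ _ (Conn-trans (Conn-sym cx) (Conn-trans xy cy))
      where
      xy = Sum.[ (λ { (refl , refl) → a~b x∉S y∉S })
               , (λ xy∈′ → Conn-edge (inj₁ xy∈′) x∉S y∉S) ] (∈-edges⇒≡ab⊎∈ xy∈)

  numComp-restoreEdge-bridge : ∀ {S k} → a ∉ S → b ∉ S → ¬ Conn G-e S a b →
                               NumComp G-e S (suc k) → NumComp G S k
  numComp-restoreEdge-bridge {S} a∉S b∉S a≁b (r , r∉S , distinct , cover) =
    numComp-fromLabelling record
      { rep          = r ∘ punchIn ib
      ; Label        = Label
      ; rep∉S        = r∉S ∘ punchIn ib
      ; rep-label    = λ j → punchIn ib j , here , merge-punchIn ia≢ib j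
      ; label-unique = λ { (_ , cx , refl) (_ , cx' , refl) → cong (merge ia≢ib) (same cx cx') }
      ; label-edge   = label-edge
      ; labelled     = labelled }
    where
    ia = proj₁ (cover a a∉S)
    ib = proj₁ (cover b b∉S)
    a~ra = proj₂ (cover a a∉S)
    b~rb = proj₂ (cover b b∉S)

    same : ∀ {x i j} → Conn G-e S x (r i) → Conn G-e S x (r j) → i ≡ j
    same cx cx' = distinct _ _ (Conn-trans (Conn-sym cx) cx')

    ia≢ib : ia ≢ ib
    ia≢ib ia≡ib =
      a≁b (Conn-trans a~ra (subst (λ i → Conn G-e S (r i) b) (sym ia≡ib) (Conn-sym b~rb)))

    Label : Fin (n G) → Fin _ → Set
    Label x j = ∃ λ i → Conn G-e S x (r i) × merge ia≢ib i ≡ j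

    label-edge : ∀ {x y i j} → (x , y) ∈ edges G → x ∉ S → y ∉ S →
                 Label x i → Label y j → i ≡ j
    label-edge xy∈ x∉S y∉S (_ , cx , refl) (_ , cy , refl) with ∈-edges⇒≡ab⊎∈ xy∈
    ... | inj₁ (refl , refl) = begin
      merge ia≢ib _  ≡⟨ cong (merge ia≢ib) (same cx a~ra) ⟩
      merge ia≢ib ia ≡⟨ merge-identifies ia≢ib ⟩
      merge ia≢ib ib ≡⟨ cong (merge ia≢ib) (same b~rb cy) ⟩
      merge ia≢ib _  ∎
      where open ≡-Reasoning
    ... | inj₂ xy∈′ =
      cong (merge ia≢ib) (same cx (Conn-trans (Conn-edge (inj₁ xy∈′) x∉S y∉S) cy))

    rb~ra : Conn G S (r ib) (r ia)
    rb~ra = Conn-trans (Conn-deleteEdge⁻ e (Conn-sym b~rb))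
                       (Conn-trans (Conn-edge (inj₂ ab∈) b∉S a∉S) (Conn-deleteEdge⁻ e a~ra))

    labelled : ∀ {x} → x ∉ S → ∃ λ j → Label x j × Conn G S x (r (punchIn ib j))
    labelled x∉S with cover _ x∉S
    ... | i , cx with i Fin.≟ ib
    ...   | yes refl = merge ia≢ib ib , (ib , cx , refl) ,
                       subst (Conn G S _ ∘ r) (sym (punchIn-merge-≡ ia≢ib))
                             (Conn-trans (Conn-deleteEdge⁻ e cx) rb~ra)
    ...   | no  i≢ib = merge ia≢ib i , (i , cx , refl) ,
                       subst (Conn G S _ ∘ r) (sym (punchIn-merge-≢ ia≢ib i≢ib)) (Conn-deleteEdge⁻ e cx)

  halfTough-bridge : ∀ {v S k} → Wedge (edges G) v a b → HalfTough G → a ∉ S → b ∉ S →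
                     ¬ Conn G-e S a b → NumComp G-e S k → 1 < k → k ≤ 2 * ∣ S ∣
  halfTough-bridge {v} {S} wedge tough a∉S b∉S a≁b comps (s≤s (s≤s {n = m} _)) with v ∈? S
  ... | no  v∉S = ⊥-elim (a≁b (Conn-trans (Conn-edge (Adjacent-sym v~a′) a∉S v∉S)
                                           (Conn-edge v~b′ v∉S b∉S)))
    where
    open Wedge wedge
    v~a′ = Adjacent-deleteEdge⁺ v≢a v≢b v~a
    v~b′ = Adjacent-deleteEdge⁺ v≢a v≢b v~b
  ... | yes v∈S = suc-≤-2*-step (x∈p⇒∣p-x∣<∣p∣ v∈S) (tough (S - v) (suc m) comps-S-v)
    where
    open Wedge wedge
    neighbour~a : ∀ {x} → Adjacent (edges G) v x → Conn G S x a
    neighbour~a v~x with neighbour⇒a⊎b v~x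
    ... | inj₁ refl = here
    ... | inj₂ refl = Conn-edge (inj₂ ab∈) b∉S a∉S
    comps-S-v : NumComp G (S - v) (suc m)
    comps-S-v = numComp-restoreVertex v∈S v~a a∉S neighbour~a
                  (numComp-restoreEdge-bridge a∉S b∉S a≁b comps)

  halfTough-deleteEdge : ∀ {v} → Wedge (edges G) v a b → HalfTough G → HalfTough G-e
  halfTough-deleteEdge wedge tough S k comps 1<k with a ∈? S | b ∈? S
  ... | yes a∈S | _ =
    tough S k (numComp-restoreEdge-connected (λ a∉S _ → ⊥-elim (a∉S a∈S)) comps) 1<k
  ... | no  _   | yes b∈S =
    tough S k (numComp-restoreEdge-connected (λ _ b∉S → ⊥-elim (b∉S b∈S)) comps) 1<k
  ... | no  a∉S | no  b∉S with Conn? comps a∉S b∉S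
  ...   | yes a~b = tough S k (numComp-restoreEdge-connected (λ _ _ → a~b) comps) 1<k
  ...   | no  a≁b = halfTough-bridge wedge tough a∉S b∉S a≁b comps 1<k

toℚ≡mkℚ : ∀ k → toℚ k ≡ mkℚ (+ k) 0 (Coprime.sym (1-coprimeTo k))
toℚ≡mkℚ k = normalize-coprime _

½*toℚ≤toℚ⇔ : ∀ k m → ½ ℚ.* toℚ k ℚ.≤ toℚ m ⇔ k ≤ 2 * m
½*toℚ≤toℚ⇔ k m rewrite toℚ≡mkℚ k | toℚ≡mkℚ m = mk⇔
  (λ le → ℤ.drop‿+≤+ (subst₂ ℤ._≤_ numerator denominator
                        (ℚᵘ.drop-*≤* (ℚᵘ.≤-respˡ-≃ homo (toℚᵘ-mono-≤ le)))))
  (λ le → toℚᵘ-cancel-≤ (ℚᵘ.≤-respˡ-≃ (ℚᵘ.≃-sym homo)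
                          (ℚᵘ.*≤* (subst₂ ℤ._≤_ (sym numerator) (sym denominator) (+≤+ le)))))
  where
  homo = toℚᵘ-homo-* ½ (mkℚ (+ k) 0 (Coprime.sym (1-coprimeTo k)))
  numerator : (+ 1 ℤ.* + k) ℤ.* + 1 ≡ + k
  numerator = trans (ℤ.*-identityʳ _) (ℤ.*-identityˡ _)
  denominator : + m ℤ.* + 2 ≡ + (2 * m)
  denominator = trans (sym (ℤ.pos-* m 2)) (cong +_ (ℕ.*-comm m 2))

tough-½⇔halfTough : ∀ G → Tough G ½ ⇔ HalfTough G
tough-½⇔halfTough G = mk⇔
  (λ tough S k comps 1<k → Equivalence.to   (½*toℚ≤toℚ⇔ k ∣ S ∣) (tough S k comps 1<k))
  (λ tough S k comps 1<k → Equivalence.from (½*toℚ≤toℚ⇔ k ∣ S ∣) (tough S k comps 1<k))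

Q₂Triangle-baseEdge : ∀ {G v a b} → Q₂Triangle (edges G) v a b →
                      ∃ λ e → ∃₂ λ a′ b′ →
                        lookup (edges G) e ≡ (a′ , b′) × Wedge (edges G) v a′ b′
Q₂Triangle-baseEdge {a = a} {b} record { wedge = wedge ; base = inj₁ ab∈ } =
  index ab∈ , a , b , sym (lookup-index ab∈) , wedge
Q₂Triangle-baseEdge {a = a} {b} record { wedge = wedge ; base = inj₂ ba∈ } =
  index ba∈ , b , a , sym (lookup-index ba∈) , Wedge-swap wedge

lemma4p7 : (T : SPT) → WF T → HasQ₂ T → (G : Graph) → IsSPGraphOf G T → ¬ MinimallyTough G ½
lemma4p7 T _ hasQ₂ G isSP ((½-tough , _) , deletion-lowers)
  with spEdges-Q₂Triangle hasQ₂
... | _ , _ , _ , spTriangle with IsSPGraphOf-Q₂Triangle {T = T} isSP spTriangle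
... | _ , _ , _ , triangle with Q₂Triangle-baseEdge triangle
... | e , _ , _ , e≡ab , wedge with deletion-lowers e
... | _ , t<½ , _ , not-tough-above =
  not-tough-above ½ t<½ (Equivalence.from (tough-½⇔halfTough (deleteEdge G e))
    (halfTough-deleteEdge e≡ab wedge (Equivalence.to (tough-½⇔halfTough G) ½-tough)))
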